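{- There are constants $c_1,c_2$ such that for all formulas $A,B$ of 3-valued Łukasiewicz logic: if $B$ is derived in $\mathcal{H}\text{Łuk}$ from $A$ in $n$ steps, then $A\supset(A\supset B)$ has an $\mathcal{H}\text{Łuk}$ proof in $c_1\cdot n$ steps and $\neg(A\supset\neg A)\supset B$ has an $\mathcal{H}\text{Łuk}$ proof in $c_2\cdot n$ steps.
   Context: Formulas are built from propositional variables with $\wedge,\vee,\supset,\neg$. $\mathcal{H}\text{Łuk}$ (Avron's Frege system for 3-valued Łukasiewicz logic Ł$_3$) has the axiom schemas: (1) $A\supset(B\supset A)$; (2) $(A\supset B)\supset((B\supset C)\supset(A\supset C))$; (3) $((A\supset B)\supset B)\supset((B\supset A)\supset A)$; (4) $((((A\supset B)\supset A)\supset A)\supset(B\supset C))\supset(B\supset C)$; (5) $(A\wedge B)\supset A$; (6) $(A\wedge B)\supset B$; (7) $(A\supset B)\supset((A\supset C)\supset(A\supset(B\wedge C)))$; (8) $A\supset(A\vee B)$; (9) $B\supset(A\vee B)$; (10) $(A\supset C)\supset((B\supset C)\supset((A\vee B)\supset C))$; (11) $(\neg B\supset\neg A)\supset(A\supset B)$; its only rule is modus ponens. A derivation of $B$ from a set $\Gamma$ is a finite sequence of formulas ending in $B$, each an axiom instance, a member of $\Gamma$, or obtained from two earlier ones by modus ponens; a proof is a derivation from $\emptyset$; the number of steps is the length of the sequence. -}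

module Defs where

open import Data.Nat using (ℕ; _≤_)
open import Data.List using (List; []; _∷ʳ_; length)
open import Data.List.Membership.Propositional using (_∈_)
open import Data.Product using (∃; Σ; _×_; _,_)
open import Data.Empty using (⊥)
open import Relation.Binary.PropositionalEquality using (_≡_)

data Formula : Set where
  var  : ℕ → Formula
  _∧_  : Formula → Formula → Formula
  _∨_  : Formula → Formula → Formula
  _⊃_  : Formula → Formula → Formula
  ¬_   : Formula → Formula

infixr 5 _⊃_
infixl 6 _∨_
infixl 7 _∧_
infix  8 ¬_

data Axiom : Formula → Set where
  ax1  : ∀ A B → Axiom (A ⊃ (B ⊃ A))
  ax2  : ∀ A B C → Axiom ((A ⊃ B) ⊃ ((B ⊃ C) ⊃ (A ⊃ C)))
  ax3  : ∀ A B → Axiom (((A ⊃ B) ⊃ B) ⊃ ((B ⊃ A) ⊃ A))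
  ax4  : ∀ A B C → Axiom (((((A ⊃ B) ⊃ A) ⊃ A) ⊃ (B ⊃ C)) ⊃ (B ⊃ C))
  ax5  : ∀ A B → Axiom ((A ∧ B) ⊃ A)
  ax6  : ∀ A B → Axiom ((A ∧ B) ⊃ B)
  ax7  : ∀ A B C → Axiom ((A ⊃ B) ⊃ ((A ⊃ C) ⊃ (A ⊃ (B ∧ C))))
  ax8  : ∀ A B → Axiom (A ⊃ (A ∨ B))
  ax9  : ∀ A B → Axiom (B ⊃ (A ∨ B))
  ax10 : ∀ A B C → Axiom ((A ⊃ C) ⊃ ((B ⊃ C) ⊃ ((A ∨ B) ⊃ C)))
  ax11 : ∀ A B → Axiom ((¬ B ⊃ ¬ A) ⊃ (A ⊃ B))

data Valid (Γ : Formula → Set) : List Formula → Set where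
  empty : Valid Γ []
  axm   : ∀ {xs φ} → Valid Γ xs → Axiom φ → Valid Γ (xs ∷ʳ φ)
  hyp   : ∀ {xs φ} → Valid Γ xs → Γ φ → Valid Γ (xs ∷ʳ φ)
  mp    : ∀ {xs φ ψ} → Valid Γ xs → φ ∈ xs → (φ ⊃ ψ) ∈ xs → Valid Γ (xs ∷ʳ ψ)

DerivIn : (Formula → Set) → ℕ → Formula → Set
DerivIn Γ n B = Σ (List Formula) λ xs → Valid Γ (xs ∷ʳ B) × length (xs ∷ʳ B) ≡ n

Only : Formula → Formula → Set
Only A φ = φ ≡ A

None : Formula → Set
None φ = ⊥

ProvableWithin : ℕ → Formula → Set
ProvableWithin m B = Σ ℕ λ k → k ≤ m × DerivIn None k B

-- Replace every formula χ of a derivation from A by A ⊃ (A ⊃ χ): this is the deduction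
-- theorem of Ł₃, where the hypothesis has to be discharged twice. Axioms and the premise A
-- translate into proofs of constant size. For modus ponens, combining A ⊃ A ⊃ φ and
-- A ⊃ A ⊃ (φ ⊃ ψ) internally yields A ⊃ A ⊃ A ⊃ A ⊃ ψ; since A ⊙ A ⊙ A = A ⊙ A in Ł₃,
-- two contractions bring this back to A ⊃ A ⊃ ψ, again with a proof of constant size.
-- Appending these fixed-size proofs to the proof built so far costs O(1) per step, so the
-- translation is linear. Finally ¬ (A ⊃ ¬ A) ⊃ B is A ⊙ A ⊃ B, obtained by uncurrying.
module Submission where

open import Defs
open import Data.Nat using (ℕ; suc; _+_; _*_; _≤_; z≤n; NonZero)
open import Data.Nat.Properties
open import Data.List using (List; []; _∷ʳ_; length)
open import Data.List.Properties using (length-++)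
open import Data.List.Membership.Propositional using (_∈_)
open import Data.List.Membership.Propositional.Properties using (∈-++⁺ˡ; ∈-++⁺ʳ; ∈-++⁻)
open import Data.List.Relation.Binary.Subset.Propositional using (_⊆_)
open import Data.List.Relation.Unary.Any using (here)
open import Data.Product using (Σ; _×_; _,_)
open import Data.Sum using (inj₁; inj₂)
open import Function using (id; _∘_)
open import Relation.Binary.PropositionalEquality using (_≡_; refl; sym; trans; cong; subst)

infix 3 _⊢_

data _⊢_ (Δ : Formula → Set) : Formula → Set where
  premise : ∀ {φ} → Δ φ → Δ ⊢ φ
  axiom   : ∀ {φ} → Axiom φ → Δ ⊢ φ
  mp      : ∀ {φ ψ} → Δ ⊢ φ ⊃ ψ → Δ ⊢ φ → Δ ⊢ ψ

-- Premises are free: they will already occur in the proof a tree is appended to.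
size : ∀ {Δ φ} → Δ ⊢ φ → ℕ
size (premise _) = 0
size (axiom _)   = 1
size (mp t u)    = suc (size t + size u)

infixr 5 _⊃²_
infixl 7 _⊙_

_⊙_ : Formula → Formula → Formula
A ⊙ B = ¬ (A ⊃ ¬ B)

_⊃²_ : Formula → Formula → Formula
A ⊃² φ = A ⊃ A ⊃ φ

module Derived {Δ : Formula → Set} where

  weaken : ∀ {φ} A → Δ ⊢ φ → Δ ⊢ A ⊃ φ
  weaken {φ} A t = mp (axiom (ax1 φ A)) t

  syllogism : ∀ {A B C} → Δ ⊢ A ⊃ B → Δ ⊢ B ⊃ C → Δ ⊢ A ⊃ C
  syllogism {A} {B} {C} t u = mp (mp (axiom (ax2 A B C)) t) u

  assertion : ∀ A B → Δ ⊢ A ⊃ (A ⊃ B) ⊃ B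
  assertion A B = syllogism (axiom (ax1 A (B ⊃ A))) (axiom (ax3 B A))

  exchange : ∀ A B C → Δ ⊢ (A ⊃ B ⊃ C) ⊃ (B ⊃ A ⊃ C)
  exchange A B C =
    syllogism (axiom (ax2 A (B ⊃ C) C)) (mp (axiom (ax2 B ((B ⊃ C) ⊃ C) (A ⊃ C))) (assertion B C))

  swap : ∀ {A B C} → Δ ⊢ A ⊃ B ⊃ C → Δ ⊢ B ⊃ A ⊃ C
  swap {A} {B} {C} = mp (exchange A B C)

  prefixing : ∀ A B C → Δ ⊢ (B ⊃ C) ⊃ (A ⊃ B) ⊃ (A ⊃ C)
  prefixing A B C = swap (axiom (ax2 A B C))

  ⊃-monoʳ : ∀ {A B C} → Δ ⊢ B ⊃ C → Δ ⊢ (A ⊃ B) ⊃ (A ⊃ C)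
  ⊃-monoʳ {A} {B} {C} = mp (prefixing A B C)

  identity : ∀ A → Δ ⊢ A ⊃ A
  identity A = mp (swap (axiom (ax1 A (A ⊃ A ⊃ A)))) (axiom (ax1 A A))

  ex-falso : ∀ A B → Δ ⊢ ¬ A ⊃ A ⊃ B
  ex-falso A B = syllogism (axiom (ax1 (¬ A) (¬ B))) (axiom (ax11 A B))

  ¬¬-elim : ∀ A → Δ ⊢ ¬ ¬ A ⊃ A
  ¬¬-elim A = mp (swap (syllogism (ex-falso (¬ A) (¬ (A ⊃ A))) (axiom (ax11 (A ⊃ A) A)))) (identity A)

  ¬¬-intro : ∀ A → Δ ⊢ A ⊃ ¬ ¬ A
  ¬¬-intro A = mp (axiom (ax11 A (¬ ¬ A))) (¬¬-elim (¬ A))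

  contraposition : ∀ A B → Δ ⊢ (A ⊃ B) ⊃ (¬ B ⊃ ¬ A)
  contraposition A B =
    syllogism (⊃-monoʳ (¬¬-intro B))
      (syllogism (mp (axiom (ax2 (¬ ¬ A) A (¬ ¬ B))) (¬¬-elim A)) (axiom (ax11 (¬ B) (¬ A))))

  uncurry : ∀ A B C → Δ ⊢ (A ⊃ B ⊃ C) ⊃ (A ⊙ B ⊃ C)
  uncurry A B C =
    syllogism (⊃-monoʳ (contraposition B C))
      (syllogism (exchange A (¬ C) (¬ B))
        (syllogism (⊃-monoʳ (¬¬-intro (A ⊃ ¬ B))) (axiom (ax11 (A ⊙ B) C))))

  pair : ∀ A B → Δ ⊢ A ⊃ B ⊃ A ⊙ B
  pair A B =
    syllogism (assertion A (¬ B))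
      (syllogism (contraposition (A ⊃ ¬ B) (¬ B)) (mp (axiom (ax2 B (¬ ¬ B) (A ⊙ B))) (¬¬-intro B)))

  -- Axiom (4), the only genuinely three-valued axiom, is used here with B := A ⊙ A.
  ⊙²-absorb : ∀ {A C} → Δ ⊢ A ⊙ A ⊃ A ⊃ C → Δ ⊢ A ⊙ A ⊃ C
  ⊙²-absorb {A} {C} t = mp (axiom (ax4 A Q C)) (syllogism ∨-A⊃Q (swap (mp (uncurry A A _) A⊃A⊃[A⊃Q]⊃C)))
    where
    Q = A ⊙ A
    ∨-A⊃Q : Δ ⊢ (((A ⊃ Q) ⊃ A) ⊃ A) ⊃ (A ⊃ Q)
    ∨-A⊃Q = mp (swap (axiom (ax3 (A ⊃ Q) A))) (pair A A)
    A⊃A⊃[A⊃Q]⊃C : Δ ⊢ A ⊃ A ⊃ (A ⊃ Q) ⊃ C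
    A⊃A⊃[A⊃Q]⊃C = syllogism (swap t) (syllogism (prefixing A Q C) (exchange (A ⊃ Q) A C))

  ⊃²-monoʳ : ∀ {A B C} → Δ ⊢ B ⊃ C → Δ ⊢ (A ⊃² B) ⊃ (A ⊃² C)
  ⊃²-monoʳ t = ⊃-monoʳ (⊃-monoʳ t)

  contract : ∀ {A C} → Δ ⊢ A ⊃ A ⊃² C → Δ ⊢ A ⊃² C
  contract {A} {C} t = mp (⊃²-monoʳ (⊙²-absorb (mp (uncurry A A (A ⊃ C)) t))) (pair A A)

  prefixing² : ∀ A B C → Δ ⊢ (B ⊃ C) ⊃ (A ⊃² B) ⊃ (A ⊃² C)
  prefixing² A B C = syllogism (prefixing A B C) (prefixing A (A ⊃ B) (A ⊃ C))

  ⊃²-distrib : ∀ {A B C} → Δ ⊢ A ⊃² (B ⊃ C) → Δ ⊢ (A ⊃² B) ⊃ A ⊃² (A ⊃² C)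
  ⊃²-distrib {A} {B} {C} t =
    swap (mp (⊃-monoʳ (exchange A (A ⊃² B) (A ⊃² C))) (mp (⊃²-monoʳ (prefixing² A B C)) t))

  ⊃²-mp : ∀ {A φ ψ} → Δ ⊢ A ⊃² φ → Δ ⊢ A ⊃² (φ ⊃ ψ) → Δ ⊢ A ⊃² ψ
  ⊃²-mp {A} {φ} {ψ} t u = contract (contract (mp (⊃²-distrib (mp (⊃²-monoʳ (assertion φ ψ)) t)) u))

open Derived

length-∷ʳ : ∀ {a} {X : Set a} (xs : List X) x → length (xs ∷ʳ x) ≡ suc (length xs)
length-∷ʳ xs x = trans (length-++ xs) (+-comm (length xs) 1)

∈-∷ʳ : ∀ {a} {X : Set a} (xs : List X) x → x ∈ xs ∷ʳ x
∈-∷ʳ xs x = ∈-++⁺ʳ xs (here refl)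

record Extension (ys : List Formula) (s : ℕ) (φ : Formula) : Set where
  field
    proof   : List Formula
    valid   : Valid None proof
    base⊆   : ys ⊆ proof
    member  : φ ∈ proof
    length≤ : length proof ≤ length ys + s

linearise : ∀ {Δ ys φ} → Valid None ys → (∀ {x} → Δ x → x ∈ ys) → (t : Δ ⊢ φ) → Extension ys (size t) φ
linearise {ys = ys} v Δ⊆ys (premise p) =
  record { proof = ys ; valid = v ; base⊆ = id ; member = Δ⊆ys p ; length≤ = m≤m+n (length ys) 0 }
linearise {ys = ys} {φ} v Δ⊆ys (axiom a) =
  record { proof = ys ∷ʳ φ ; valid = axm v a ; base⊆ = ∈-++⁺ˡ ; member = ∈-∷ʳ ys φ ; length≤ = ≤-reflexive (length-++ ys) }
linearise {ys = ys} {ψ} v Δ⊆ys (mp t u) = record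
  { proof   = zs ∷ʳ ψ
  ; valid   = mp (valid e₂) (member e₂) (base⊆ e₂ (member e₁))
  ; base⊆   = ∈-++⁺ˡ ∘ base⊆ e₂ ∘ base⊆ e₁
  ; member  = ∈-∷ʳ zs ψ
  ; length≤ = bound
  }
  where
  open Extension
  e₁ = linearise v Δ⊆ys t
  e₂ = linearise (valid e₁) (base⊆ e₁ ∘ Δ⊆ys) u
  zs = proof e₂
  bound : length (zs ∷ʳ ψ) ≤ length ys + size (mp t u)
  bound = begin
    length (zs ∷ʳ ψ)                          ≡⟨ length-∷ʳ zs ψ ⟩
    suc (length zs)                           ≤⟨ +-monoʳ-≤ 1 (length≤ e₂) ⟩
    suc (length (proof e₁) + size u)          ≤⟨ +-monoʳ-≤ 1 (+-monoˡ-≤ (size u) (length≤ e₁)) ⟩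
    suc (length ys + size t + size u)         ≡⟨ cong suc (+-assoc (length ys) (size t) (size u)) ⟩
    suc (length ys + (size t + size u))       ≡⟨ sym (+-suc (length ys) (size t + size u)) ⟩
    length ys + size (mp t u)                 ∎
    where open ≤-Reasoning

record Translation (Γ : Formula → Set) (τ : Formula → Formula) (k : ℕ) : Set₁ where
  field
    axiom-case   : ∀ {Δ φ} → Axiom φ → Δ ⊢ τ φ
    premise-case : ∀ {Δ φ} → Γ φ → Δ ⊢ τ φ
    mp-case      : ∀ {Δ φ ψ} → Δ (τ φ) → Δ (τ (φ ⊃ ψ)) → Δ ⊢ τ ψ
    axiom-size   : ∀ {Δ φ} (a : Axiom φ) → size (axiom-case {Δ} a) ≤ k
    premise-size : ∀ {Δ φ} (p : Γ φ) → size (premise-case {Δ} p) ≤ k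
    mp-size      : ∀ {Δ φ ψ} (p : Δ (τ φ)) (q : Δ (τ (φ ⊃ ψ))) → size (mp-case {Δ} {φ} {ψ} p q) ≤ k

record Simulation (τ : Formula → Formula) (k : ℕ) (xs : List Formula) : Set where
  field
    proof   : List Formula
    valid   : Valid None proof
    image   : ∀ {χ} → χ ∈ xs → τ χ ∈ proof
    length≤ : length proof ≤ k * length xs

extend : ∀ {τ k xs φ} (σ : Simulation τ k xs) (t : (_∈ Simulation.proof σ) ⊢ τ φ) → size t ≤ k →
         Simulation τ k (xs ∷ʳ φ)
extend {τ} {k} {xs} {φ} σ t t≤k = record
  { proof = Extension.proof e ; valid = Extension.valid e ; image = image′ ; length≤ = bound }
  where
  open Simulation σ
  e = linearise valid id t
  image′ : ∀ {χ} → χ ∈ xs ∷ʳ φ → τ χ ∈ Extension.proof e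
  image′ χ∈ with ∈-++⁻ xs χ∈
  ... | inj₁ χ∈xs        = Extension.base⊆ e (image χ∈xs)
  ... | inj₂ (here refl) = Extension.member e
  bound : length (Extension.proof e) ≤ k * length (xs ∷ʳ φ)
  bound = begin
    length (Extension.proof e) ≤⟨ Extension.length≤ e ⟩
    length proof + size t      ≤⟨ +-mono-≤ length≤ t≤k ⟩
    k * length xs + k          ≡⟨ +-comm (k * length xs) k ⟩
    k + k * length xs          ≡⟨ sym (*-suc k (length xs)) ⟩
    k * suc (length xs)        ≡⟨ cong (k *_) (sym (length-∷ʳ xs φ)) ⟩
    k * length (xs ∷ʳ φ)       ∎
    where open ≤-Reasoning

module _ {Γ τ k} (T : Translation Γ τ k) where
  open Translation T

  simulate : ∀ {xs} → Valid Γ xs → Simulation τ k xs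
  simulate empty      = record { proof = [] ; valid = empty ; image = λ () ; length≤ = z≤n }
  simulate (axm v a)  = extend (simulate v) (axiom-case a) (axiom-size a)
  simulate (hyp v p)  = extend (simulate v) (premise-case p) (premise-size p)
  simulate (mp {φ = φ} {ψ} v i j) =
    extend σ (mp-case {φ = φ} {ψ} (image i) (image j)) (mp-size {φ = φ} {ψ} (image i) (image j))
    where
    σ = simulate v
    open Simulation σ

-- A derivation must end in its conclusion, so φ is derived once more from φ and φ ⊃ φ.
derivation-ending-in : ∀ {ys φ} → Valid None ys → φ ∈ ys → DerivIn None (3 + length ys) φ
derivation-ending-in {ys} {φ} v φ∈ys =
  ys ∷ʳ (φ ⊃ φ ⊃ φ) ∷ʳ (φ ⊃ φ) ,
  mp (mp (axm v (ax1 φ φ)) (∈-++⁺ˡ φ∈ys) (∈-∷ʳ ys _)) (∈-++⁺ˡ (∈-++⁺ˡ φ∈ys)) (∈-∷ʳ _ _) ,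
  trans (length-∷ʳ (ys ∷ʳ (φ ⊃ φ ⊃ φ) ∷ʳ (φ ⊃ φ)) φ)
    (cong suc (trans (length-∷ʳ (ys ∷ʳ (φ ⊃ φ ⊃ φ)) (φ ⊃ φ)) (cong suc (length-∷ʳ ys (φ ⊃ φ ⊃ φ)))))

affine≤linear : ∀ k c n .{{_ : NonZero n}} → k * n + c ≤ (k + c) * n
affine≤linear k c n = begin
  k * n + c      ≤⟨ +-monoʳ-≤ (k * n) (m≤m*n c n) ⟩
  k * n + c * n  ≡⟨ sym (*-distribʳ-+ n k c) ⟩
  (k + c) * n    ∎
  where open ≤-Reasoning

translate : ∀ {Γ τ k n B φ} s → Translation Γ τ k → DerivIn Γ n B →
            (t : Only (τ B) ⊢ φ) → size t ≤ s → ProvableWithin ((k + (s + 3)) * n) φ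
translate {k = k} {B = B} s T (xs , v , refl) t t≤s =
  3 + length (Extension.proof e) , bound , derivation-ending-in (Extension.valid e) (Extension.member e)
  where
  σ = simulate T v
  open Simulation σ
  e = linearise valid (λ { refl → image (∈-∷ʳ xs B) }) t
  n = length (xs ∷ʳ B)
  instance
    n-nonZero : NonZero n
    n-nonZero = subst NonZero (sym (length-∷ʳ xs B)) _
  bound : 3 + length (Extension.proof e) ≤ (k + (s + 3)) * n
  bound = begin
    3 + length (Extension.proof e) ≤⟨ +-monoʳ-≤ 3 (Extension.length≤ e) ⟩
    3 + (length proof + size t)    ≤⟨ +-monoʳ-≤ 3 (+-mono-≤ length≤ t≤s) ⟩
    3 + (k * n + s)                ≡⟨ +-comm 3 (k * n + s) ⟩
    k * n + s + 3                  ≡⟨ +-assoc (k * n) s 3 ⟩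
    k * n + (s + 3)                ≤⟨ affine≤linear k (s + 3) n ⟩
    (k + (s + 3)) * n              ∎
    where open ≤-Reasoning

-- 1691 and 188 are the sizes of the trees ⊃²-mp and mp (uncurry A A B) (premise refl);
-- sizes do not depend on the formulas, so ≤-refl checks them by normalisation.
⊃²-translation : ∀ A → Translation (Only A) (A ⊃²_) 1691
⊃²-translation A = record
  { axiom-case   = weaken A ∘ weaken A ∘ axiom
  ; premise-case = λ { refl → axiom (ax1 A A) }
  ; mp-case      = λ p q → ⊃²-mp (premise p) (premise q)
  ; axiom-size   = λ _ → ≤ᵇ⇒≤ 5 1691 _
  ; premise-size = λ { refl → ≤ᵇ⇒≤ 1 1691 _ }
  ; mp-size      = λ _ _ → ≤-refl
  }

lemma1 : Σ ℕ λ c₁ → Σ ℕ λ c₂ → (A B : Formula) (n : ℕ) → DerivIn (Only A) n B → ProvableWithin (c₁ * n) (A ⊃ (A ⊃ B)) × ProvableWithin (c₂ * n) (¬ (A ⊃ ¬ A) ⊃ B)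
lemma1 = 1691 + (0 + 3) , 1691 + (188 + 3) , λ A B n d →
  translate 0 (⊃²-translation A) d (premise refl) z≤n ,
  translate 188 (⊃²-translation A) d (mp (uncurry A A B) (premise refl)) ≤-refl
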